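{- Let $\mathbf{D}$ be a finite $2$-semilattice and let $\mathcal{I}=(X,(P_x)_{x\in X},(R_{xy})_{(x,y)\in X^2})$ be a standard $(2,3)$-instance of $\mathrm{CSP}(\mathbf{D})$ in which every potato $\mathbf{P}_x$ and every relation $\mathbf{R}_{xy}$ has strongly connected digraph, and let $u\in X$ with $|P_u|>1$. Choose a maximal congruence $\alpha_u$ of $\mathbf{P}_u$, let $W\subseteq X$ and $\varphi_{xu}$ ($x\in W$), the classes $P_u^1,\dots,P_u^k$ of $\alpha_u$, and the instances $\mathcal{I}_1,\dots,\mathcal{I}_k$ be as described in the context. Then: (1) for $x\in W$, every $y\in X$ and every $i$, $R_{xy}\cap(P_x^{\mathcal{I}_i}\times P_y)=R_{xy}\cap(P_x^{\mathcal{I}_i}\times P_y^{\mathcal{I}_i})$; (2) every solution of $\mathcal{I}$ is a solution of $\mathcal{I}_i$ for some $i$; (3) for $x\in W$ there is a congruence $\alpha_x$ of $\mathbf{P}_x$ such that $\mathbf{P}_x/\alpha_x\cong\mathbf{P}_u/\alpha_u$ via the isomorphism $P_x^{\mathcal{I}_i}\mapsto P_u^{\mathcal{I}_i}$.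
   Context: A $2$-semilattice is an algebra with one binary operation $\cdot$ satisfying $x\cdot x\approx x$, $x\cdot y\approx y\cdot x$, $x\cdot(x\cdot y)\approx x\cdot y$; its digraph has edge $a\longrightarrow b$ iff $a\cdot b=b$. A standard $(2,3)$-instance of $\mathrm{CSP}(\mathbf{D})$ is a triple $(X,(P_x),(R_{xy}))$ with $X$ finite, each $P_x$ ("potato") a subuniverse of $\mathbf{D}$, each $R_{xy}$ a subuniverse of $\mathbf{D}^2$ with $R_{xy}\subseteq P_x\times P_y$, satisfying: (P1) $R_{xx}=\{(a,a):a\in P_x\}$; (P2) for all $x,y,z\in X$ and $(a,b)\in R_{xy}$ there is $c\in P_z$ with $(a,c)\in R_{xz}$ and $(b,c)\in R_{yz}$; (P3) $R_{xy}$ is a subdirect product of $\mathbf{P}_x\times\mathbf{P}_y$ when $P_x,P_y$ are nonempty; (P4) $R_{yx}=\{(b,a):(a,b)\in R_{xy}\}$. A solution is a map $s$ on $X$ with $s(x)\in P_x$ and $(s(x),s(y))\in R_{xy}$ for all $x,y$. Decomposition: $W$ is the set of $x\in X$ such that $\{(a,b/\alpha_u):(a,b)\in R_{xu}\}$ is the graph of a surjective homomorphism $\varphi_{xu}:\mathbf{P}_x\to\mathbf{P}_u/\alpha_u$; $P_u^1,\dots,P_u^k$ are the $\alpha_u$-classes; the instance $\mathcal{I}_i$ has variable set $X$, potatoes $P_x^{\mathcal{I}_i}=\varphi_{xu}^{ -1}(P_u^i)$ if $x\in W$ and $P_x^{\mathcal{I}_i}=P_x$ otherwise, and relations $R_{xy}^{\mathcal{I}_i}=R_{xy}\cap(P_x^{\mathcal{I}_i}\times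 P_y^{\mathcal{I}_i})$. -}

module Defs where

open import Data.Nat using (ℕ)
open import Data.Fin using (Fin)
open import Data.Product using (Σ; ∃; ∃-syntax; _×_; _,_)
open import Data.Sum using (_⊎_)
open import Relation.Nullary using (¬_)
open import Relation.Binary.PropositionalEquality using (_≡_; _≢_)

record TwoSemilattice (n : ℕ) : Set where
  field
    _·_    : Fin n → Fin n → Fin n
    idem   : ∀ x → x · x ≡ x
    comm   : ∀ x y → x · y ≡ y · x
    absorb : ∀ x y → x · (x · y) ≡ x · y

data Path {A : Set} (S : A → Set) (E : A → A → Set) : A → A → Set where
  here : ∀ {a} → S a → Path S E a a
  step : ∀ {a b c} → S a → E a b → Path S E b c → Path S E a c

StronglyConnected : {A : Set} → (A → Set) → (A → A → Set) → Set
StronglyConnected S E = ∀ a b → S a → S b → Path S E a b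

module _ {n : ℕ} (D : TwoSemilattice n) where
  open TwoSemilattice D

  Edge : Fin n → Fin n → Set
  Edge a b = a · b ≡ b

  Edge² : Fin n × Fin n → Fin n × Fin n → Set
  Edge² (a , b) (c , d) = (a · c ≡ c) × (b · d ≡ d)

  IsSubuniverse : (Fin n → Set) → Set
  IsSubuniverse P = ∀ {a b} → P a → P b → P (a · b)

  IsSubuniverse² : (Fin n → Fin n → Set) → Set
  IsSubuniverse² R = ∀ {a b a' b'} → R a b → R a' b' → R (a · a') (b · b')

  record Congruence (P : Fin n → Set) : Set₁ where
    field
      θ      : Fin n → Fin n → Set
      θ⊆     : ∀ {a b} → θ a b → P a × P b
      θrefl  : ∀ {a} → P a → θ a a
      θsym   : ∀ {a b} → θ a b → θ b a
      θtrans : ∀ {a b c} → θ a b → θ b c → θ a c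
      θcompat : ∀ {a b a' b'} → θ a b → θ a' b' → θ (a · a') (b · b')
  open Congruence public

  IsMaximal : {P : Fin n → Set} → Congruence P → Set₁
  IsMaximal {P} α =
    (∃[ a ] ∃[ b ] (P a × P b × ¬ θ α a b)) ×
    ((ψ : Congruence P) → (∀ {a b} → θ α a b → θ ψ a b) →
       (∀ {a b} → θ ψ a b → θ α a b) ⊎ (∀ a b → P a → P b → θ ψ a b))

  record Instance (m : ℕ) : Set₁ where
    field
      P    : Fin m → Fin n → Set
      R    : Fin m → Fin m → Fin n → Fin n → Set
      Psub : ∀ x → IsSubuniverse (P x)
      Rsub : ∀ x y → IsSubuniverse² (R x y)
      R⊆   : ∀ {x y a b} → R x y a b → P x a × P y b
      P1   : ∀ x a b → (R x x a b → P x a × a ≡ b) × (P x a × a ≡ b → R x x a b)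
      P2   : ∀ x y z a b → R x y a b → ∃[ c ] (P z c × R x z a c × R y z b c)
      P3   : ∀ x y → (∃[ a ] P x a) → (∃[ b ] P y b) →
               (∀ a → P x a → ∃[ b ] R x y a b) × (∀ b → P y b → ∃[ a ] R x y a b)
      P4   : ∀ x y a b → (R x y a b → R y x b a) × (R y x b a → R x y a b)

  module _ {m : ℕ} (I : Instance m) where
    open Instance I

    AllStronglyConnected : Set
    AllStronglyConnected =
      (∀ x → StronglyConnected (P x) Edge) ×
      (∀ x y → StronglyConnected (λ p → R x y (Data.Product.proj₁ p) (Data.Product.proj₂ p)) Edge²)

    IsSolutionOf : (Fin m → Fin n → Set) → (Fin m → Fin m → Fin n → Fin n → Set) →
                   (Fin m → Fin n) → Set
    IsSolutionOf Q S s = (∀ x → Q x (s x)) × (∀ x y → S x y (s x) (s y))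

    module _ (u : Fin m) (α : Congruence (P u)) where
      -- G x a c :  a ↦ c/α_u  under {(a , b/α_u) : (a , b) ∈ R_xu}
      G : Fin m → Fin n → Fin n → Set
      G x a c = ∃[ b ] (R x u a b × θ α b c)

      -- x ∈ W : G x is the graph of a surjective homomorphism P_x → P_u/α_u
      InW : Fin m → Set
      InW x =
        (∀ a → P x a → ∃[ c ] (P u c × G x a c)) ×
        (∀ a c c' → G x a c → G x a c' → θ α c c') ×
        (∀ a a' c c' → G x a c → G x a' c' → G x (a · a') (c · c')) ×
        (∀ c → P u c → ∃[ a ] (P x a × G x a c))

      -- the instance I_c, for the α_u-class of c ∈ P_u :
      -- P^c_x = φ_xu⁻¹(c/α_u) if x ∈ W, and P_x otherwise
      Pᴵ : Fin n → Fin m → Fin n → Set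
      Pᴵ c x a = P x a × (InW x → G x a c)

      Rᴵ : Fin n → Fin m → Fin m → Fin n → Fin n → Set
      Rᴵ c x y a b = R x y a b × Pᴵ c x a × Pᴵ c y b

      H : Fin m → Fin n → Fin n → Set
      H x a c' = ∃[ c ] (P u c × Pᴵ c x a × Pᴵ c u c')

      -- H x is the graph of an isomorphism P_x/αx → P_u/α_u
      IsIsoGraph : (x : Fin m) → Congruence (P x) → Set
      IsIsoGraph x αx =
        (∀ a → P x a → ∃[ c ] (P u c × H x a c)) ×
        (∀ c → P u c → ∃[ a ] (P x a × H x a c)) ×
        (∀ a a' c → H x a c → θ αx a a' → H x a' c) ×
        (∀ a c c' → H x a c → θ α c c' → H x a c') ×
        (∀ a a' c c' → H x a c → H x a' c' →
           (θ αx a a' → θ α c c') × (θ α c c' → θ αx a a')) ×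
        (∀ a a' c c' → H x a c → H x a' c' → H x (a · a') (c · c'))

      Part1 : Set
      Part1 = ∀ x → InW x → ∀ y c → P u c → ∀ a b →
        ((R x y a b × Pᴵ c x a × P y b) → (R x y a b × Pᴵ c x a × Pᴵ c y b)) ×
        ((R x y a b × Pᴵ c x a × Pᴵ c y b) → (R x y a b × Pᴵ c x a × P y b))

      Part2 : Set
      Part2 = ∀ s → IsSolutionOf P R s → ∃[ c ] (P u c × IsSolutionOf (Pᴵ c) (Rᴵ c) s)

      Part3 : Set₁
      Part3 = ∀ x → InW x → Σ (Congruence (P x)) (λ αx → IsIsoGraph x αx)

-- Since
-- R_uu is the diagonal, G u is α_u itself, so u ∈ W and membership of a ∈ P_x in
-- the class of c is detected by G x a c.  (1) holds because (P2) gives a common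
-- witness d ∈ P_u of R_xu a d and R_yu b d, and functionality of φ_xu puts d in the
-- class of a.  (2) takes the class of s(u).  (3) takes α_x to be the kernel of φ_xu.
module Submission where

open import Defs
open import Data.Nat using (ℕ)
open import Data.Fin using (Fin)
open import Data.Product using (_×_; ∃-syntax; _,_; proj₁; proj₂)
open import Relation.Binary.PropositionalEquality using (_≢_; refl)

module Decomposition {n m : ℕ} (D : TwoSemilattice n) (I : Instance D m)
                     (u : Fin m) (α : Congruence D (Instance.P I u)) where
  open TwoSemilattice D
  open Instance I
  open Congruence α using ()
    renaming (θ to _≈u_; θ⊆ to ≈u⇒P; θrefl to ≈u-refl; θsym to ≈u-sym; θtrans to ≈u-trans;
              θcompat to ≈u-compat)

  φ : Fin m → Fin n → Fin n → Set
  φ = G D I u α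

  W : Fin m → Set
  W = InW D I u α

  φ-resp-≈u : ∀ {x a c c'} → φ x a c → c ≈u c' → φ x a c'
  φ-resp-≈u (b , r , b≈c) c≈c' = b , r , ≈u-trans b≈c c≈c'

  φ⇒P : ∀ {x a c} → φ x a c → P x a × P u c
  φ⇒P (_ , r , b≈c) = proj₁ (R⊆ r) , proj₂ (≈u⇒P b≈c)

  φ-functional : ∀ {x a c c'} → W x → φ x a c → φ x a c' → c ≈u c'
  φ-functional (_ , functional , _ , _) = functional _ _ _

  φ-of-R : ∀ {x a b} → R x u a b → φ x a b
  φ-of-R r = _ , r , ≈u-refl (proj₂ (R⊆ r))

  φu-refl : ∀ {c} → P u c → φ u c c
  φu-refl pc = φ-of-R (proj₂ (P1 u _ _) (pc , refl))

  φu⇒≈u : ∀ {c d} → φ u c d → c ≈u d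
  φu⇒≈u (_ , r , b≈d) with proj₁ (P1 u _ _) r
  ... | _ , refl = b≈d

  u∈W : W u
  u∈W = (λ c pc → c , pc , φu-refl pc)
      , (λ _ _ _ g g' → ≈u-trans (≈u-sym (φu⇒≈u g)) (φu⇒≈u g'))
      , (λ _ _ _ _ g g' → φ-resp-≈u (φu-refl (Psub u (proj₁ (φ⇒P g)) (proj₁ (φ⇒P g'))))
                                    (≈u-compat (φu⇒≈u g) (φu⇒≈u g')))
      , (λ c pc → c , pc , φu-refl pc)

  φ⇒H : ∀ {x a c} → φ x a c → H D I u α x a c
  φ⇒H g = let pa , pc = φ⇒P g in _ , pc , (pa , λ _ → g) , (pc , λ _ → φu-refl pc)

  H⇒φ : ∀ {x a c} → W x → H D I u α x a c → φ x a c
  H⇒φ x∈W (_ , _ , (_ , a∈class) , (_ , c∈class)) =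
    φ-resp-≈u (a∈class x∈W) (≈u-sym (φu⇒≈u (c∈class u∈W)))

  W-constraints-respect-classes : Part1 D I u α
  W-constraints-respect-classes x x∈W y c _ a b =
      (λ { (r , (pa , a∈class) , pb) → r , (pa , a∈class) , (pb , λ _ →
             let _ , _ , rxu , ryu = P2 x y u a b r
             in φ-resp-≈u (φ-of-R ryu) (φ-functional x∈W (φ-of-R rxu) (a∈class x∈W))) })
    , (λ { (r , pa , (pb , _)) → r , pa , pb })

  solution-in-class-of-s-u : Part2 D I u α
  solution-in-class-of-s-u s (ps , rs) = s u , ps u , ps′ , λ x y → rs x y , ps′ x , ps′ y
    where
    ps′ : ∀ x → Pᴵ D I u α (s u) x (s x)
    ps′ x = ps x , λ _ → φ-of-R (rs x u)

  module Kernel (x : Fin m) (x∈W : W x) where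
    private
      total      = proj₁ x∈W
      hom        = proj₁ (proj₂ (proj₂ x∈W))
      surjective = proj₂ (proj₂ (proj₂ x∈W))

    ker : Congruence D (P x)
    ker = record
      { θ       = λ a a' → P x a × P x a' × ∃[ c ] (φ x a c × φ x a' c)
      ; θ⊆      = λ { (pa , pa' , _) → pa , pa' }
      ; θrefl   = λ pa → let c , _ , g = total _ pa in pa , pa , c , g , g
      ; θsym    = λ { (pa , pa' , c , g , g') → pa' , pa , c , g' , g }
      ; θtrans  = λ { (pa , _ , c , g , g') (_ , pa'' , _ , h , h') →
                      pa , pa'' , c , g , φ-resp-≈u h' (φ-functional x∈W h g') }
      ; θcompat = λ { (pa , pa' , _ , g , g') (pb , pb' , _ , h , h') →
                      Psub x pa pb , Psub x pa' pb' , _ , hom _ _ _ _ g h , hom _ _ _ _ g' h' }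
      }

    ker-isoGraph : IsIsoGraph D I u α x ker
    ker-isoGraph =
        (λ a pa → let c , pc , g = total a pa in c , pc , φ⇒H g)
      , (λ c pc → let a , pa , g = surjective c pc in a , pa , φ⇒H g)
      , (λ { _ _ _ h (_ , _ , _ , g , g') →
             φ⇒H (φ-resp-≈u g' (φ-functional x∈W g (H⇒φ x∈W h))) })
      , (λ _ _ _ h c≈c' → φ⇒H (φ-resp-≈u (H⇒φ x∈W h) c≈c'))
      , (λ _ _ c _ h h' →
             (λ { (_ , _ , _ , g , g') →
                  ≈u-trans (φ-functional x∈W (H⇒φ x∈W h) g) (φ-functional x∈W g' (H⇒φ x∈W h')) })
           , (λ c≈c' → let g = H⇒φ x∈W h ; g' = H⇒φ x∈W h' in
                  proj₁ (φ⇒P g) , proj₁ (φ⇒P g') , c , g , φ-resp-≈u g' (≈u-sym c≈c')))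
      , (λ _ _ _ _ h h' → φ⇒H (hom _ _ _ _ (H⇒φ x∈W h) (H⇒φ x∈W h')))

  kernel-is-isomorphic-quotient : Part3 D I u α
  kernel-is-isomorphic-quotient x x∈W = Kernel.ker x x∈W , Kernel.ker-isoGraph x x∈W

lemma5p7 : ∀ {n m : ℕ} (D : TwoSemilattice n) (I : Instance D m) →
    AllStronglyConnected D I →
    (u : Fin m) →
    (∃[ a ] ∃[ b ] (Instance.P I u a × Instance.P I u b × a ≢ b)) →
    (α : Congruence D (Instance.P I u)) → IsMaximal D α →
    Part1 D I u α × Part2 D I u α × Part3 D I u α
lemma5p7 D I _ u _ α _ =
  W-constraints-respect-classes , solution-in-class-of-s-u , kernel-is-isomorphic-quotient
  where open Decomposition D I u α
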